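{- (1) $\chi_{NL}(F_n)=4$ for $4\le n\le 10$. (2) $\chi_{NL}(W_n)=4$ for $n\in\{4,6,8,10\}$. (3) $\chi_{NL}(W_n)=5$ for $n\in\{5,7,9\}$.
   Context: All graphs are finite, simple, undirected and connected. The fan $F_n$ (resp. wheel $W_n$) of order $n$ is obtained from the path $P_{n-1}$ (resp. cycle $C_{n-1}$) of order $n-1$ by adding a new vertex adjacent to every vertex. A $k$-coloring of a graph $G$ is a partition of $V(G)$ into $k$ independent sets (colors). A coloring $\{S_1,\dots,S_k\}$ is neighbor-locating (an NL-coloring) if for any two distinct vertices $u,v$ in the same color class, $\{j: N(u)\cap S_j\neq\emptyset\}\neq\{j: N(v)\cap S_j\neq\emptyset\}$. The neighbor-locating chromatic number $\chi_{NL}(G)$ is the minimum number of colors in an NL-coloring of $G$. -}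

module Defs where

open import Data.Nat using (ℕ; zero; suc; _<_; _∸_)
open import Data.Fin using (Fin; toℕ)
open import Data.Product using (Σ; ∃; _×_)
open import Data.Sum using (_⊎_)
open import Relation.Nullary using (¬_)
open import Relation.Binary.PropositionalEquality using (_≡_; _≢_)
open import Function.Bundles using (_⇔_)

Graph : ℕ → Set₁
Graph n = Fin n → Fin n → Set

-- Fan F_n: vertex 0 is the hub, vertices 1,…,n-1 form the path P_{n-1}
-- (i ~ i+1), and the hub is adjacent to every other vertex.
FanAdj : (n : ℕ) → Graph n
FanAdj n u v =
    (toℕ u ≡ 0 × toℕ v ≢ 0)
  ⊎ (toℕ v ≡ 0 × toℕ u ≢ 0)
  ⊎ (toℕ u ≢ 0 × toℕ v ≡ suc (toℕ u))
  ⊎ (toℕ v ≢ 0 × toℕ u ≡ suc (toℕ v))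

-- Wheel W_n: the fan plus the closing edge {1, n-1} of the cycle C_{n-1}
-- (used for n ≥ 4, so that C_{n-1} is a genuine cycle).
WheelAdj : (n : ℕ) → Graph n
WheelAdj n u v =
    FanAdj n u v
  ⊎ (toℕ u ≡ 1 × toℕ v ≡ n ∸ 1)
  ⊎ (toℕ v ≡ 1 × toℕ u ≡ n ∸ 1)

-- A k-coloring: a map to Fin k whose colour classes are independent
-- and all nonempty (a partition of V(G) into k independent sets).
IsColoring : {n : ℕ} → Graph n → (k : ℕ) → (Fin n → Fin k) → Set
IsColoring {n} G k c =
    (∀ u v → G u v → c u ≢ c v)
  × (∀ (j : Fin k) → ∃ λ v → c v ≡ j)

NbrHasColor : {n k : ℕ} → Graph n → (Fin n → Fin k) → Fin n → Fin k → Set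
NbrHasColor G c u j = ∃ λ v → G u v × c v ≡ j

IsNLColoring : {n : ℕ} → Graph n → (k : ℕ) → (Fin n → Fin k) → Set
IsNLColoring {n} G k c =
    IsColoring G k c
  × (∀ u v → u ≢ v → c u ≡ c v →
       ¬ (∀ j → NbrHasColor G c u j ⇔ NbrHasColor G c v j))

HasNLColoring : {n : ℕ} → Graph n → ℕ → Set
HasNLColoring {n} G k = ∃ λ (c : Fin n → Fin k) → IsNLColoring G k c

χNL≡ : {n : ℕ} → Graph n → ℕ → Set
χNL≡ G m = HasNLColoring G m × (∀ k → k < m → ¬ HasNLColoring G k)

module Submission where

-- Each claim χ_NL(G) = m concerns one fixed small graph, so it
-- splits into an upper bound (an explicit NL m-colouring, checked by a
-- decision procedure for the NL property) and a lower bound (no NL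
-- k-colouring for any k < m, checked by an exhaustive search).

open import Defs
open import Data.Nat as ℕ using (ℕ; zero; suc; _<_; _≤_; _∸_; s≤s)
open import Data.Nat.Properties using (≤∧≢⇒<)
open import Data.Fin using (Fin; zero; toℕ; #_; _≟_)
open import Data.Fin.Properties using (all?; any?)
open import Data.Vec using (Vec; []; _∷_; lookup)
open import Data.Vec.Functional using (updateAt)
open import Data.Vec.Functional.Properties using (updateAt-updates; updateAt-minimal)
open import Data.Bool using (Bool; true; T; not; _∧_)
open import Data.Bool.Properties using (T-∧; T-not-≡)
open import Data.List using (List; []; _∷_; allFin)
open import Data.Bool.ListAction using (any)
open import Data.List.Relation.Unary.Any using (here; there)
open import Data.List.Relation.Unary.Any.Properties using (any⁺)
open import Data.List.Membership.Propositional using (_∉_; lose)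
open import Data.List.Membership.Propositional.Properties using (∈-allFin)
open import Data.Product using (∃; _×_; _,_)
open import Data.Empty using (⊥-elim)
open import Function using (const; _∘_)
open import Function.Bundles using (_⇔_; mk⇔; Equivalence)
open import Relation.Nullary using (¬_; Dec; yes; no)
open import Relation.Nullary.Decidable
  using (True; isYes; fromWitness; toWitness; map′; _×-dec_; _⊎-dec_; _→-dec_; ¬?)
open import Relation.Binary.PropositionalEquality
  using (_≡_; _≢_; _≗_; refl; sym; trans; subst)

_⇔?_ : {A B : Set} → Dec A → Dec B → Dec (A ⇔ B)
a? ⇔? b? = map′ (λ (f , g) → mk⇔ f g) (λ e → Equivalence.to e , Equivalence.from e)
                ((a? →-dec b?) ×-dec (b? →-dec a?))

module NeighborLocating {n : ℕ} (G : Graph n) (G? : ∀ u v → Dec (G u v)) {k : ℕ} where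

  nbrHasColor? : (c : Fin n → Fin k) → ∀ u j → Dec (NbrHasColor G c u j)
  nbrHasColor? c u j = any? (λ v → G? u v ×-dec c v ≟ j)

  isColoring? : (c : Fin n → Fin k) → Dec (IsColoring G k c)
  isColoring? c = (all? λ u → all? λ v → G? u v →-dec ¬? (c u ≟ c v))
            ×-dec (all? λ j → any? λ v → c v ≟ j)

  isNL? : (c : Fin n → Fin k) → Dec (IsNLColoring G k c)
  isNL? c = isColoring? c
      ×-dec (all? λ u → all? λ v → ¬? (u ≟ v) →-dec (c u ≟ c v →-dec
               ¬? (all? λ j → nbrHasColor? c u j ⇔? nbrHasColor? c v j)))

  nbrHasColor-resp-≗ : ∀ {c d : Fin n → Fin k} → c ≗ d → ∀ u j →
                       NbrHasColor G c u j → NbrHasColor G d u j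
  nbrHasColor-resp-≗ c≗d u j (v , uv , cv≡j) = v , uv , trans (sym (c≗d v)) cv≡j

  isNL-resp-≗ : ∀ {c d : Fin n → Fin k} → c ≗ d →
                IsNLColoring G k c → IsNLColoring G k d
  isNL-resp-≗ {c} {d} c≗d ((proper , onto) , locating) =
    (proper′ , onto′) , locating′
    where
    d⇒c : ∀ {u v} → d u ≡ d v → c u ≡ c v
    d⇒c {u} {v} eq = trans (c≗d u) (trans eq (sym (c≗d v)))
    proper′ : ∀ u v → G u v → d u ≢ d v
    proper′ u v uv = proper u v uv ∘ d⇒c
    onto′ : ∀ j → ∃ λ v → d v ≡ j
    onto′ j with v , cv≡j ← onto j = v , trans (sym (c≗d v)) cv≡j
    back : ∀ u j → NbrHasColor G d u j → NbrHasColor G c u j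
    back = nbrHasColor-resp-≗ (sym ∘ c≗d)
    forth : ∀ u j → NbrHasColor G c u j → NbrHasColor G d u j
    forth = nbrHasColor-resp-≗ c≗d
    locating′ : ∀ u v → u ≢ v → d u ≡ d v →
                ¬ (∀ j → NbrHasColor G d u j ⇔ NbrHasColor G d v j)
    locating′ u v u≢v eq same = locating u v u≢v (d⇒c eq) λ j →
      mk⇔ (back v j ∘ Equivalence.to (same j) ∘ forth u j)
          (back u j ∘ Equivalence.from (same j) ∘ forth v j)

  open import Data.List.Membership.DecPropositional (_≟_ {n}) using (_∉?_)

  -- A partial colouring is a total map s together with the list of vertices
  -- still to be coloured; s is meaningful only off that list.
  Fits : (todo : List (Fin n)) → Fin n → Fin k → (Fin n → Fin k) → Set
  Fits todo v x s = ∀ u → G v u → u ∉ todo → x ≢ s u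

  fits? : ∀ todo v x s → Dec (Fits todo v x s)
  fits? todo v x s = all? λ u → G? v u →-dec (u ∉? todo →-dec ¬? (x ≟ s u))

  search : List (Fin n) → (Fin n → Fin k) → Bool
  search []         s = isYes (isNL? s)
  search (v ∷ todo) s =
    any (λ x → isYes (fits? (v ∷ todo) v x s) ∧ search todo (updateAt s v (const x)))
        (allFin k)

  Extends : (Fin n → Fin k) → List (Fin n) → (Fin n → Fin k) → Set
  Extends c todo s = ∀ u → u ∉ todo → s u ≡ c u

  extends-step : ∀ {c v todo s} → Extends c (v ∷ todo) s →
                 Extends c todo (updateAt s v (const (c v)))
  extends-step {c} {v} {todo} {s} ext u u∉todo with u ≟ v
  ... | yes refl = updateAt-updates u s
  ... | no u≢v   = trans (updateAt-minimal u v s u≢v) (ext u u∉v∷todo)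
    where
    u∉v∷todo : u ∉ v ∷ todo
    u∉v∷todo (here u≡v)     = u≢v u≡v
    u∉v∷todo (there u∈todo) = u∉todo u∈todo

  colour-fits : ∀ {c v todo s} → IsColoring G k c → Extends c (v ∷ todo) s →
                Fits (v ∷ todo) v (c v) s
  colour-fits (proper , _) ext u vu u∉ cv≡su = proper _ u vu (trans cv≡su (ext u u∉))

  search-complete : ∀ {c} → IsNLColoring G k c →
                    ∀ todo s → Extends c todo s → T (search todo s)
  search-complete nl [] s ext =
    fromWitness {a? = isNL? s} (isNL-resp-≗ (λ u → sym (ext u λ ())) nl)
  search-complete {c} nl@(coloring , _) (v ∷ todo) s ext =
    any⁺ _ (lose (∈-allFin (c v))
      (Equivalence.from T-∧
        ( fromWitness {a? = fits? (v ∷ todo) v (c v) s} (colour-fits coloring ext)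
        , search-complete nl todo _ (extends-step ext))))

module ByComputation {n : ℕ} (G : Graph (suc n)) (G? : ∀ u v → Dec (G u v)) where

  open module NL {k} = NeighborLocating G G? {k} using (isNL?; search; search-complete)

  -- The search refutes NL k-colourings.  With no colours there is no
  -- colouring at all, since G has a vertex; otherwise the search starts
  -- from the empty partial colouring.
  refutes : ℕ → Bool
  refutes zero    = true
  refutes (suc k) = not (search {suc k} (allFin (suc n)) (const zero))

  refutes-sound : ∀ k → T (refutes k) → ¬ HasNLColoring G k
  refutes-sound zero    _       (c , _)  with () ← c zero
  refutes-sound (suc k) refuted (c , nl) =
    subst T (Equivalence.to T-not-≡ refuted)
      (search-complete nl (allFin (suc n)) (const zero) nothing-coloured)
    where
    nothing-coloured : ∀ u → u ∉ allFin (suc n) → zero ≡ c u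
    nothing-coloured u u∉ = ⊥-elim (u∉ (∈-allFin u))

  refutesBelow : ℕ → Bool
  refutesBelow zero    = true
  refutesBelow (suc m) = refutes m ∧ refutesBelow m

  refutesBelow-sound : ∀ m → T (refutesBelow m) → ∀ k → k < m → ¬ HasNLColoring G k
  refutesBelow-sound (suc m) refuted k k<1+m
    with at-m , below-m ← Equivalence.to (T-∧ {refutes m}) refuted | k ℕ.≟ m
  ... | yes refl = refutes-sound k at-m
  ... | no k≢m   = refutesBelow-sound m below-m k (≤∧≢⇒< (ℕ.≤-pred k<1+m) k≢m)

  certify : ∀ m (colours : Vec (Fin m) (suc n)) →
                  True (isNL? (lookup colours)) → T (refutesBelow m) → χNL≡ G m
  certify m colours is-NL refuted =
    (lookup colours , toWitness is-NL) , refutesBelow-sound m refuted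

fan? : ∀ n u v → Dec (FanAdj n u v)
fan? n u v =
      (toℕ u ℕ.≟ 0 ×-dec ¬? (toℕ v ℕ.≟ 0))
  ⊎-dec (toℕ v ℕ.≟ 0 ×-dec ¬? (toℕ u ℕ.≟ 0))
  ⊎-dec (¬? (toℕ u ℕ.≟ 0) ×-dec toℕ v ℕ.≟ suc (toℕ u))
  ⊎-dec (¬? (toℕ v ℕ.≟ 0) ×-dec toℕ u ℕ.≟ suc (toℕ v))

wheel? : ∀ n u v → Dec (WheelAdj n u v)
wheel? n u v =
      fan? n u v
  ⊎-dec (toℕ u ℕ.≟ 1 ×-dec toℕ v ℕ.≟ n ∸ 1)
  ⊎-dec (toℕ v ℕ.≟ 1 ×-dec toℕ u ℕ.≟ n ∸ 1)

-- The fan F_{n+1} and the wheel W_{n+1}, with hub 0 and rim 1, …, n.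
module Fan (n : ℕ) = ByComputation (FanAdj (suc n)) (fan? (suc n))
module Wheel (n : ℕ) = ByComputation (WheelAdj (suc n)) (wheel? (suc n))

theorem19 :
    ((n : ℕ) → 4 ≤ n → n ≤ 10 → χNL≡ (FanAdj n) 4)
    × (χNL≡ (WheelAdj 4) 4 × χNL≡ (WheelAdj 6) 4 × χNL≡ (WheelAdj 8) 4 × χNL≡ (WheelAdj 10) 4)
    × (χNL≡ (WheelAdj 5) 5 × χNL≡ (WheelAdj 7) 5 × χNL≡ (WheelAdj 9) 5)
theorem19 =
    fans
  , ( Wheel.certify 3 4 (# 0 ∷ # 1 ∷ # 2 ∷ # 3 ∷ []) _ _
    , Wheel.certify 5 4 (# 0 ∷ # 1 ∷ # 2 ∷ # 1 ∷ # 2 ∷ # 3 ∷ []) _ _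
    , Wheel.certify 7 4 (# 0 ∷ # 1 ∷ # 2 ∷ # 1 ∷ # 2 ∷ # 3 ∷ # 1 ∷ # 3 ∷ []) _ _
    , Wheel.certify 9 4 (# 0 ∷ # 1 ∷ # 2 ∷ # 1 ∷ # 2 ∷ # 3 ∷ # 2 ∷ # 3 ∷ # 1 ∷ # 3 ∷ []) _ _ )
  , ( Wheel.certify 4 5 (# 0 ∷ # 1 ∷ # 2 ∷ # 3 ∷ # 4 ∷ []) _ _
    , Wheel.certify 6 5 (# 0 ∷ # 1 ∷ # 2 ∷ # 1 ∷ # 2 ∷ # 3 ∷ # 4 ∷ []) _ _
    , Wheel.certify 8 5 (# 0 ∷ # 1 ∷ # 2 ∷ # 1 ∷ # 2 ∷ # 3 ∷ # 1 ∷ # 2 ∷ # 4 ∷ []) _ _ )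
  where
  fans : (n : ℕ) → 4 ≤ n → n ≤ 10 → χNL≡ (FanAdj n) 4
  fans 4  _ _ = Fan.certify 3 4 (# 0 ∷ # 1 ∷ # 2 ∷ # 3 ∷ []) _ _
  fans 5  _ _ = Fan.certify 4 4 (# 0 ∷ # 1 ∷ # 2 ∷ # 1 ∷ # 3 ∷ []) _ _
  fans 6  _ _ = Fan.certify 5 4 (# 0 ∷ # 1 ∷ # 2 ∷ # 1 ∷ # 3 ∷ # 1 ∷ []) _ _
  fans 7  _ _ = Fan.certify 6 4 (# 0 ∷ # 1 ∷ # 2 ∷ # 1 ∷ # 3 ∷ # 2 ∷ # 3 ∷ []) _ _
  fans 8  _ _ = Fan.certify 7 4 (# 0 ∷ # 1 ∷ # 2 ∷ # 1 ∷ # 3 ∷ # 1 ∷ # 3 ∷ # 2 ∷ []) _ _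
  fans 9  _ _ = Fan.certify 8 4 (# 0 ∷ # 1 ∷ # 2 ∷ # 1 ∷ # 3 ∷ # 1 ∷ # 3 ∷ # 2 ∷ # 3 ∷ []) _ _
  fans 10 _ _ = Fan.certify 9 4 (# 0 ∷ # 1 ∷ # 2 ∷ # 3 ∷ # 2 ∷ # 3 ∷ # 1 ∷ # 3 ∷ # 1 ∷ # 2 ∷ []) _ _
  fans 0 () _
  fans 1 (s≤s ()) _
  fans 2 (s≤s (s≤s ())) _
  fans 3 (s≤s (s≤s (s≤s ()))) _
  fans (suc (suc (suc (suc (suc (suc (suc (suc (suc (suc (suc _))))))))))) _
       (s≤s (s≤s (s≤s (s≤s (s≤s (s≤s (s≤s (s≤s (s≤s (s≤s ()))))))))))
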